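{- There is a deterministic algorithm that, given as input an instance of $\mathsf{ShiftFinding}_{c,n}$ together with an integer $s<n$, makes $2$ queries to $F_{s^*}$ and returns 'yes' if $s=s^*$ and 'no' otherwise.
   Context: An instance of Shift Finding $\mathsf{ShiftFinding}_{c,n}$ (with $c,n>1$) consists of a string $P\in\{0,1\}^{(c-1)n}$ (fully known to the algorithm) together with query access to a string $F_{s^*}$ which is the concatenation of $n-s^*$ zeros, then $P$, then $s^*$ ones, for an unknown $s^*\in[0,n]$; a query at $x\in[0,cn]$ returns $F_{s^*}(x)$. -}

module Defs where

open import Data.Bool using (Bool; true; false)
open import Data.Nat using (ℕ; zero; suc; _+_; _∸_; _<?_)
open import Data.Fin using (Fin; toℕ; fromℕ<)
open import Data.Vec using (Vec; lookup)
open import Relation.Nullary using (yes; no)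

-- Shift Finding instance data.
-- The known pattern P has length L = (c-1)n, so the total string has
-- length c*n = n + L.  Positions are 0-indexed: Fin (n + L).
--
-- F n L P s x  =  x-th bit of  0^(n-s) ++ P ++ 1^s   (intended for s ≤ n).
F : (n L : ℕ) → Vec Bool L → ℕ → Fin (n + L) → Bool
F n L P s x with toℕ x <? (n ∸ s)
... | yes _ = false
... | no _ with (toℕ x ∸ (n ∸ s)) <? L
...   | yes p = lookup P (fromℕ< p)
...   | no _ = true

-- Deterministic (adaptive) query algorithms making exactly k queries
-- to a string of length N, then outputting a Bool (true = 'yes').
data QAlg (N : ℕ) : ℕ → Set where
  output : Bool → QAlg N zero
  query  : {k : ℕ} → Fin N → (Bool → QAlg N k) → QAlg N (suc k)

run : {N k : ℕ} → QAlg N k → (Fin N → Bool) → Bool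
run (output b) f = b
run (query x next) f = run (next (f x)) f

{-# OPTIONS --safe #-}
-- Write F_s as the infinite word 0^(n-s) P 1^ω, read on the window [0, n+L).  For the guess k,
-- let a be the first 1 and b the last 0 of F_k in the window, and accept iff F_{s*} agrees with
-- F_k at a and at b.  If s* < k then F_{s*} is F_k moved to the right, so it is still 0 at a
-- (where F_k is 1); if s* > k then F_{s*} is F_k moved to the left, so it is already 1 at b
-- (where F_k is 0).
module Submission where

open import Defs
open import Data.Bool using (Bool; true; false; _∧_)
open import Data.Bool.Properties using (_≟_)
open import Data.Nat using (ℕ; zero; suc; _+_; _∸_; _≤_; z≤n; s≤s; _<?_; _≤?_; compare; less; equal; greater)
open import Data.Nat as ℕ using ()
open import Data.Nat.Properties
  using (<⇒≱; ≰⇒>; ≮⇒≥; <⇒≤; ≤-refl; ≤-trans; n≤1+n; m<n⇒m<1+n; m≤n⇒m<n∨m≡n; m≤m+n; m<n+m;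
         +-comm; +-monoˡ-≤; m∸n≤m; ∸-cancelˡ-≡)
open import Data.Integer using (ℤ; +_; -[1+_]; _<_; +<+)
open import Data.Integer.Properties using (+-injective)
open import Data.Fin using (Fin; zero; toℕ; fromℕ<)
open import Data.Fin.Properties using (toℕ-fromℕ<)
open import Data.Vec using (Vec; lookup)
open import Data.Product using (Σ-syntax; _×_; _,_; proj₁; proj₂)
open import Data.Sum using (inj₁; inj₂)
open import Data.Empty using (⊥-elim)
open import Function using (_∘_)
open import Function.Bundles using (_⇔_; mk⇔; Equivalence)
open import Function.Construct.Composition using (_⇔-∘_)
open import Relation.Nullary using (yes; no; contradiction)
open import Relation.Nullary.Decidable using (⌊_⌋)
open import Relation.Binary.PropositionalEquality using (_≡_; _≢_; refl; sym; trans; cong; subst)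

firstTrue : (ℕ → Bool) → ℕ → ℕ
firstTrue g zero = zero
firstTrue g (suc B) with g zero
... | true = zero
... | false = suc (firstTrue (g ∘ suc) B)

firstTrue-≤ : ∀ (g : ℕ → Bool) B → firstTrue g B ≤ B
firstTrue-≤ g zero = z≤n
firstTrue-≤ g (suc B) with g zero
... | true = z≤n
... | false = s≤s (firstTrue-≤ (g ∘ suc) B)

firstTrue-minimal : ∀ (g : ℕ → Bool) B {y} → y ℕ.< firstTrue g B → g y ≡ false
firstTrue-minimal g (suc B) {y} y<first with g zero in g0
firstTrue-minimal g (suc B) {zero} _ | false = g0
firstTrue-minimal g (suc B) {suc y} (s≤s y<first) | false = firstTrue-minimal (g ∘ suc) B y<first

firstTrue-true : ∀ (g : ℕ → Bool) B {y} → y ≤ B → g y ≡ true → g (firstTrue g B) ≡ true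
firstTrue-true g zero z≤n gy = gy
firstTrue-true g (suc B) {y} y≤B gy with g zero in g0
... | true = g0
firstTrue-true g (suc B) {zero} _ gy | false = contradiction (trans (sym g0) gy) λ ()
firstTrue-true g (suc B) {suc y} (s≤s y≤B) gy | false = firstTrue-true (g ∘ suc) B y≤B gy

lastFalse : (ℕ → Bool) → ℕ → ℕ
lastFalse g zero = zero
lastFalse g (suc B) with g (suc B)
... | true = lastFalse g B
... | false = suc B

lastFalse-≤ : ∀ (g : ℕ → Bool) B → lastFalse g B ≤ B
lastFalse-≤ g zero = z≤n
lastFalse-≤ g (suc B) with g (suc B)
... | true = ≤-trans (lastFalse-≤ g B) (n≤1+n B)
... | false = ≤-refl

lastFalse-maximal : ∀ (g : ℕ → Bool) B {y} → lastFalse g B ℕ.< y → y ≤ B → g y ≡ true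
lastFalse-maximal g zero last<y y≤0 = contradiction y≤0 (<⇒≱ last<y)
lastFalse-maximal g (suc B) {y} last<y y≤B with g (suc B) in gB
... | false = contradiction y≤B (<⇒≱ last<y)
... | true with m≤n⇒m<n∨m≡n y≤B
...   | inj₁ (s≤s y≤B′) = lastFalse-maximal g B last<y y≤B′
...   | inj₂ refl = gB

lastFalse-false : ∀ (g : ℕ → Bool) B {y} → y ≤ B → g y ≡ false → g (lastFalse g B) ≡ false
lastFalse-false g zero z≤n gy = gy
lastFalse-false g (suc B) {y} y≤B gy with g (suc B) in gB
... | false = gB
... | true with m≤n⇒m<n∨m≡n y≤B
...   | inj₁ (s≤s y≤B′) = lastFalse-false g B y≤B′ gy
...   | inj₂ refl = contradiction (trans (sym gB) gy) λ ()

module _ {L : ℕ} (P : Vec Bool L) where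

  extend : ℕ → Bool
  extend i with i <? L
  ... | yes i<L = lookup P (fromℕ< i<L)
  ... | no _ = true

  shifted : ℕ → ℕ → Bool
  shifted zero x = extend x
  shifted (suc m) zero = false
  shifted (suc m) (suc x) = shifted m x

  extend-ones : ∀ {i} → L ≤ i → extend i ≡ true
  extend-ones {i} L≤i with i <? L
  ... | yes i<L = contradiction L≤i (<⇒≱ i<L)
  ... | no _ = refl

  shifted-zeros : ∀ {m x} → x ℕ.< m → shifted m x ≡ false
  shifted-zeros {suc m} {zero} _ = refl
  shifted-zeros {suc m} {suc x} (s≤s x<m) = shifted-zeros x<m

  shifted-ones : ∀ {m x} → m + L ≤ x → shifted m x ≡ true
  shifted-ones {zero} L≤x = extend-ones L≤x
  shifted-ones {suc m} {suc x} (s≤s m+L≤x) = shifted-ones m+L≤x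

  shifted-extend : ∀ {m x} → m ≤ x → shifted m x ≡ extend (x ∸ m)
  shifted-extend {zero} _ = refl
  shifted-extend {suc m} {suc x} (s≤s m≤x) = shifted-extend m≤x

  shifted-+ : ∀ d m x → shifted (d + m) (d + x) ≡ shifted m x
  shifted-+ zero m x = refl
  shifted-+ (suc d) m x = shifted-+ d m x

  shifted-right-of-first : ∀ {m} d a →
    (∀ y → y ℕ.< a → shifted m y ≡ false) → shifted (suc d + m) a ≡ false
  shifted-right-of-first d zero _ = refl
  shifted-right-of-first zero (suc a) before-a = before-a a ≤-refl
  shifted-right-of-first (suc d) (suc a) before-a =
    shifted-right-of-first d a (λ y y<a → before-a y (m<n⇒m<1+n y<a))

  shifted-left-of-last : ∀ {m} d b →
    (∀ y → b ℕ.< y → shifted (suc d + m) y ≡ true) → shifted m b ≡ true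
  shifted-left-of-last {m} d b after-b =
    trans (sym (shifted-+ (suc d) m b)) (after-b (suc d + b) (m<n+m b (s≤s z≤n)))

F≗shifted : ∀ n L (P : Vec Bool L) s x → F n L P s x ≡ shifted P (n ∸ s) (toℕ x)
F≗shifted n L P s x with toℕ x <? n ∸ s
... | yes x<m = sym (shifted-zeros P x<m)
... | no x≮m rewrite shifted-extend P (≮⇒≥ x≮m) with toℕ x ∸ (n ∸ s) <? L
...   | yes _ = refl
...   | no _ = refl

module _ {L : ℕ} (P : Vec Bool L) (B : ℕ) where

  first-separates : ∀ m d → suc (m + d) + L ≤ suc B →
    let a = firstTrue (shifted P m) B in shifted P (suc (m + d)) a ≢ shifted P m a
  first-separates m d (s≤s m+d+L≤B) agree =
    contradiction (trans (sym shifted-a) (trans agree G-a)) λ ()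
    where
    G = shifted P m
    a = firstTrue G B
    m+L≤B : m + L ≤ B
    m+L≤B = ≤-trans (+-monoˡ-≤ L (m≤m+n m d)) m+d+L≤B
    G-a : G a ≡ true
    G-a = firstTrue-true G B m+L≤B (shifted-ones P {m} ≤-refl)
    shifted-a : shifted P (suc (m + d)) a ≡ false
    shifted-a = subst (λ k → shifted P (suc k) a ≡ false) (+-comm d m)
                  (shifted-right-of-first P d a (λ _ → firstTrue-minimal G B))

  last-separates : ∀ m d → suc (m + d) + L ≤ suc B →
    let b = lastFalse (shifted P (suc (m + d))) B in shifted P m b ≢ shifted P (suc (m + d)) b
  last-separates m d bound@(s≤s m+d+L≤B) agree =
    contradiction (trans (sym shifted-b) (trans agree G-b)) λ ()
    where
    G = shifted P (suc (m + d))
    b = lastFalse G B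
    m≤B : m ≤ B
    m≤B = ≤-trans (m≤m+n m d) (≤-trans (m≤m+n (m + d) L) m+d+L≤B)
    G-b : G b ≡ false
    G-b = lastFalse-false G B m≤B (shifted-zeros P (s≤s (m≤m+n m d)))
    G-after-b : ∀ y → b ℕ.< y → G y ≡ true
    G-after-b y b<y with y ≤? B
    ... | yes y≤B = lastFalse-maximal G B b<y y≤B
    ... | no y≰B = shifted-ones P (≤-trans bound (≰⇒> y≰B))
    shifted-b : shifted P m b ≡ true
    shifted-b = shifted-left-of-last P d b
                  (subst (λ k → ∀ y → b ℕ.< y → shifted P (suc k) y ≡ true) (+-comm m d) G-after-b)

  shifts-agree⇒≡ : ∀ m m* → m + L ≤ suc B → m* + L ≤ suc B →
    let a = firstTrue (shifted P m) B; b = lastFalse (shifted P m) B in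
    shifted P m* a ≡ shifted P m a → shifted P m* b ≡ shifted P m b → m ≡ m*
  shifts-agree⇒≡ m m* m+L≤ m*+L≤ agree-a agree-b with compare m m*
  ... | less _ d = contradiction agree-a (first-separates m d m*+L≤)
  ... | equal _ = refl
  ... | greater _ d = contradiction agree-b (last-separates m* d m+L≤)

agreementTest : ∀ {N} → (Fin N → Bool) → Fin N → Fin N → QAlg N 2
agreementTest g i j = query i λ fi → query j λ fj → output (⌊ fi ≟ g i ⌋ ∧ ⌊ fj ≟ g j ⌋)

run-agreementTest : ∀ {N} (g f : Fin N → Bool) i j →
  (run (agreementTest g i j) f ≡ true) ⇔ (f i ≡ g i × f j ≡ g j)
run-agreementTest g f i j with f i ≟ g i | f j ≟ g j
... | yes fi≡gi | yes fj≡gj = mk⇔ (λ _ → fi≡gi , fj≡gj) (λ _ → refl)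
... | yes _ | no fj≢gj = mk⇔ (λ ()) (⊥-elim ∘ fj≢gj ∘ proj₂)
... | no fi≢gi | _ = mk⇔ (λ ()) (⊥-elim ∘ fi≢gi ∘ proj₁)

shiftTest : (B : ℕ) → (ℕ → Bool) → QAlg (suc B) 2
shiftTest B G =
  agreementTest (G ∘ toℕ) (fromℕ< (s≤s (firstTrue-≤ G B))) (fromℕ< (s≤s (lastFalse-≤ G B)))

shiftTest-correct : ∀ {L} (P : Vec Bool L) B m m* (f : Fin (suc B) → Bool) →
  (∀ x → f x ≡ shifted P m* (toℕ x)) → m + L ≤ suc B → m* + L ≤ suc B →
  (run (shiftTest B (shifted P m)) f ≡ true) ⇔ (m ≡ m*)
shiftTest-correct P B m m* f f≗ m+L≤ m*+L≤ = mk⇔ to from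
  where
  G = shifted P m
  a<1+B = s≤s (firstTrue-≤ G B)
  b<1+B = s≤s (lastFalse-≤ G B)
  i = fromℕ< a<1+B
  j = fromℕ< b<1+B
  agreement = run-agreementTest (G ∘ toℕ) f i j
  agree-at : ∀ {x} (x<1+B : x ℕ.< suc B) →
    f (fromℕ< x<1+B) ≡ G (toℕ (fromℕ< x<1+B)) → shifted P m* x ≡ G x
  agree-at x<1+B eq = subst (λ y → shifted P m* y ≡ G y) (toℕ-fromℕ< x<1+B) (trans (sym (f≗ _)) eq)
  to : run (shiftTest B G) f ≡ true → m ≡ m*
  to accepted with Equivalence.to agreement accepted
  ... | fi , fj = shifts-agree⇒≡ P B m m* m+L≤ m*+L≤ (agree-at a<1+B fi) (agree-at b<1+B fj)
  from : m ≡ m* → run (shiftTest B G) f ≡ true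
  from refl = Equivalence.from agreement (f≗ i , f≗ j)

reject : ∀ {B} → QAlg (suc B) 2
reject = query zero λ _ → query zero λ _ → output false

shiftFinder : (n L : ℕ) → 1 ℕ.< n → 0 ℕ.< L → Vec Bool L → (s : ℤ) → s < + n → QAlg (n + L) 2
shiftFinder (suc n) L _ _ P (+ k) _ = shiftTest (n + L) (shifted P (suc n ∸ k))
shiftFinder (suc n) L _ _ P -[1+ _ ] _ = reject

n∸k≡n∸s⇔+k≡+s : ∀ {n k s} → k ≤ n → s ≤ n → (n ∸ k ≡ n ∸ s) ⇔ (+ k ≡ + s)
n∸k≡n∸s⇔+k≡+s k≤n s≤n = mk⇔ (cong +_ ∘ ∸-cancelˡ-≡ k≤n s≤n) (cong (_ ∸_) ∘ +-injective)

shiftFinder-correct : (n L : ℕ) (hn : 1 ℕ.< n) (hL : 0 ℕ.< L) (P : Vec Bool L) (s : ℤ) (hs : s < + n)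
  (s* : ℕ) → s* ≤ n → (run (shiftFinder n L hn hL P s hs) (F n L P s*) ≡ true) ⇔ (s ≡ + s*)
shiftFinder-correct (suc n) L _ _ P (+ k) (+<+ k<n) s* s*≤n =
  n∸k≡n∸s⇔+k≡+s (<⇒≤ k<n) s*≤n
  ⇔-∘ shiftTest-correct P (n + L) (suc n ∸ k) (suc n ∸ s*) (F (suc n) L P s*) (F≗shifted (suc n) L P s*)
        (+-monoˡ-≤ L (m∸n≤m (suc n) k)) (+-monoˡ-≤ L (m∸n≤m (suc n) s*))
shiftFinder-correct (suc n) L _ _ P -[1+ _ ] _ s* _ = mk⇔ (λ ()) (λ ())

lemma1p9 : Σ[ A ∈ ((n L : ℕ) → 1 ℕ.< n → 0 ℕ.< L → Vec Bool L → (s : ℤ) → s < + n → QAlg (n + L) 2) ]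
    ((n L : ℕ) (hn : 1 ℕ.< n) (hL : 0 ℕ.< L) (P : Vec Bool L) (s : ℤ) (hs : s < + n) (s* : ℕ) → s* ≤ n →
    ((run (A n L hn hL P s hs) (F n L P s*) ≡ true) ⇔ (s ≡ + s*)))
lemma1p9 = shiftFinder , shiftFinder-correct
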